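{- Let $u\equiv 0\pmod 4$, $u\geq 8$. Then the graph $\langle \mathbb Z_u\cup\{\infty_1,\infty_2\},\{2\}\rangle$ can be decomposed into $3$-suns.
   Context: A $3$-sun is the graph on six vertices $a,b,c,d,e,f$ with edges $\{a,b\},\{b,c\},\{c,a\},\{a,d\},\{b,e\},\{c,f\}$; a decomposition of a graph into $3$-suns is a partition of its edge set into subgraphs isomorphic to a $3$-sun. For a positive integer $u$, $\mathbb Z_u=\{0,1,\dots,u-1\}$ (integers mod $u$), and for distinct $i,j\in\mathbb Z_u$, $|i-j|_u=\min\{|i-j|,u-|i-j|\}$. For a set $H$ disjoint from $\mathbb Z_u$ and a nonempty set $D\subseteq\{1,\dots,\lfloor u/2\rfloor\}$, $\langle \mathbb Z_u\cup H,D\rangle$ is the graph with vertex set $\mathbb Z_u\cup H$ and edge set $\{\{i,j\}: i,j\in\mathbb Z_u,\ |i-j|_u\in D\}\cup\{\{\infty,i\}:\infty\in H,\ i\in\mathbb Z_u\}$. -}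

module Defs where

open import Data.Nat using (ℕ; _≤_; _⊓_; _∸_; ∣_-_∣)
open import Data.Fin using (Fin; toℕ)
open import Data.Sum using (_⊎_; inj₁; inj₂)
open import Data.Product using (_×_; Σ; _,_)
open import Data.List using (List; length; lookup)
open import Data.Empty using (⊥)
open import Data.Unit using (⊤)
open import Level using (0ℓ)
open import Relation.Binary.PropositionalEquality using (_≡_)
open import Function.Definitions using (Injective)

record Graph : Set₁ where
  field
    V : Set
    E : V → V → Set
open Graph public

cdist : (u : ℕ) → Fin u → Fin u → ℕ
cdist u i j = ∣ toℕ i - toℕ j ∣ ⊓ (u ∸ ∣ toℕ i - toℕ j ∣)

-- ⟨ Z_u ∪ H , D ⟩ with H = {∞_0,…,∞_{h-1}} (Fin h), D given as a predicate on ℕ.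
-- Requires i ≠ j for pure edges (D ⊆ {1..⌊u/2⌋} in the paper makes this automatic).
cayleyE : (u h : ℕ) → (ℕ → Set) → (Fin u ⊎ Fin h) → (Fin u ⊎ Fin h) → Set
cayleyE u h D (inj₁ i) (inj₁ j) = (i ≡ j → ⊥) × D (cdist u i j)
cayleyE u h D (inj₁ i) (inj₂ ∞) = ⊤
cayleyE u h D (inj₂ ∞) (inj₁ i) = ⊤
cayleyE u h D (inj₂ ∞) (inj₂ ∞′) = ⊥

Cayley : (u h : ℕ) → (ℕ → Set) → Graph
Cayley u h D = record { V = Fin u ⊎ Fin h ; E = cayleyE u h D }

data SunVertex : Set where
  a b c d e f : SunVertex

data SunEdge : Set where
  ab bc ca ad be cf : SunEdge

sunEnds : SunEdge → SunVertex × SunVertex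
sunEnds ab = a , b
sunEnds bc = b , c
sunEnds ca = c , a
sunEnds ad = a , d
sunEnds be = b , e
sunEnds cf = c , f

record Sun (G : Graph) : Set where
  field
    vx    : SunVertex → V G
    inj   : Injective _≡_ _≡_ vx
    edges : (s : SunEdge) → let (p , q) = sunEnds s in E G (vx p) (vx q)
open Sun public

EdgeIs : {G : Graph} → Sun G → SunEdge → V G → V G → Set
EdgeIs S s x y = let (p , q) = sunEnds s in
  (vx S p ≡ x × vx S q ≡ y) ⊎ (vx S p ≡ y × vx S q ≡ x)

record SunDecomposition (G : Graph) : Set where
  field
    suns   : List (Sun G)
    cover  : ∀ x y → E G x y →
             Σ (Fin (length suns)) λ i → Σ SunEdge λ s → EdgeIs (lookup suns i) s x y
    unique : ∀ x y → E G x y → ∀ i i′ s s′ →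
             EdgeIs (lookup suns i) s x y → EdgeIs (lookup suns i′) s′ x y →
             (i ≡ i′) × (s ≡ s′)

-- Write u = 4K and let (q , j , h) ∈ ℤ_K × ℤ_2 × ℤ_2 stand for the vertex 4q + 2j + h of ℤ_u.
-- The distance-2 edges then form two cycles (one for each h), each running
-- (q,0,h) → (q,1,h) → (q+1,0,h) → …. For every q and h take the 3-sun with triangle
-- (q,0,h), (q,1,h), ∞_h and pendant edges (q,0,h) ∞_{1-h}, (q,1,h) (q+1,0,h), ∞_h (q,1,1-h).
-- Each sun takes the two cycle edges leaving (q,0,h) and (q,1,h), and the two suns of block q
-- join each of its four points to each of ∞₀, ∞₁ exactly once; K ≥ 2 keeps the six vertices
-- of a sun distinct. Conversely every edge determines the sun and sun edge covering it
-- (label below), which gives uniqueness.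
module Submission where

open import Data.Bool using (if_then_else_)
open import Data.Empty using (⊥-elim)
open import Data.Fin as Fin using (Fin; zero; toℕ; combine; remQuot; cast)
open import Data.Fin.Patterns using (0F; 1F)
open import Data.Fin.Properties
  using (toℕ<n; toℕ-injective; toℕ-fromℕ<; toℕ-combine; remQuot-combine; combine-remQuot;
         cast-involutive; *↔×)
open import Data.List using (List; length; lookup; tabulate)
open import Data.List.Properties using (length-tabulate; lookup-tabulate)
open import Data.Nat
open import Data.Nat.DivMod using (_%_; _mod_; m%n<n; m<n⇒m%n≡m; [m+n]%n≡m%n)
open import Data.Nat.Divisibility using (_∣_; divides)
open import Data.Nat.Properties
open import Data.Nat.Tactic.RingSolver using (solve-∀)
open import Data.Product using (_×_; _,_; Σ; proj₁; proj₂; map₂; uncurry)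
open import Data.Sum using (_⊎_; inj₁; inj₂)
open import Data.Unit using (tt)
open import Function using (_∘_)
open import Function.Bundles using (_↔_; Inverse)
open import Function.Definitions using (Injective)
open import Relation.Nullary using (Dec; does; ¬_; yes; no)
open import Relation.Nullary.Decidable using (dec-true; dec-false; _⊎-dec_; map′)
open import Relation.Binary.PropositionalEquality
open import Defs

open ≡-Reasoning

if-does-yes : ∀ {P : Set} {A : Set} (P? : Dec P) {x y : A} → P → (if does P? then x else y) ≡ x
if-does-yes P? {x} {y} p = cong (if_then x else y) (dec-true P? p)

if-does-no : ∀ {P : Set} {A : Set} (P? : Dec P) {x y : A} → ¬ P → (if does P? then x else y) ≡ y
if-does-no P? {x} {y} ¬p = cong (if_then x else y) (dec-false P? ¬p)

-- y ≡ x + k in ℤ_n, for representatives x, y < n.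
data Ahead (n k x y : ℕ) : Set where
  direct : x + k ≡ y → Ahead n k x y
  wrap   : x + k ≡ y + n → Ahead n k x y

ahead? : ∀ n k x y → Dec (Ahead n k x y)
ahead? n k x y = map′ to-ahead from-ahead ((x + k ≟ y) ⊎-dec (x + k ≟ y + n))
  where
  to-ahead : x + k ≡ y ⊎ x + k ≡ y + n → Ahead n k x y
  to-ahead (inj₁ p) = direct p
  to-ahead (inj₂ p) = wrap p
  from-ahead : Ahead n k x y → x + k ≡ y ⊎ x + k ≡ y + n
  from-ahead (direct p) = inj₁ p
  from-ahead (wrap p) = inj₂ p

ahead-mod : ∀ {n k x} .{{_ : NonZero n}} → x < n → k ≤ n → Ahead n k x ((x + k) % n)
ahead-mod {n} {k} {x} x<n k≤n with x + k <? n
... | yes x+k<n = direct (sym (m<n⇒m%n≡m x+k<n))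
... | no x+k≮n = wrap (begin
  x + k                   ≡⟨ m∸n+n≡m n≤x+k ⟨
  x + k ∸ n + n           ≡⟨ cong (_+ n) (m<n⇒m%n≡m wrapped<n) ⟨
  (x + k ∸ n) % n + n     ≡⟨ cong (_+ n) ([m+n]%n≡m%n (x + k ∸ n) n) ⟨
  (x + k ∸ n + n) % n + n ≡⟨ cong (λ z → z % n + n) (m∸n+n≡m n≤x+k) ⟩
  (x + k) % n + n         ∎)
  where
  n≤x+k : n ≤ x + k
  n≤x+k = ≮⇒≥ x+k≮n
  wrapped<n : x + k ∸ n < n
  wrapped<n = m<n+o⇒m∸n<o (x + k) n (+-mono-<-≤ x<n k≤n)

ahead-unique : ∀ {n k x y₁ y₂} → y₁ < n → y₂ < n → Ahead n k x y₁ → Ahead n k x y₂ → y₁ ≡ y₂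
ahead-unique _ _ (direct p) (direct q) = trans (sym p) q
ahead-unique {n} y₁<n _ (direct p) (wrap q) =
  ⊥-elim (<⇒≱ y₁<n (subst (n ≤_) (trans (sym q) p) (m≤n+m n _)))
ahead-unique {n} _ y₂<n (wrap p) (direct q) =
  ⊥-elim (<⇒≱ y₂<n (subst (n ≤_) (trans (sym p) q) (m≤n+m n _)))
ahead-unique {n} _ _ (wrap p) (wrap q) = +-cancelʳ-≡ n _ _ (trans (sym p) q)

ahead-self : ∀ {n k x} → Ahead n k x x → k ≡ 0 ⊎ k ≡ n
ahead-self {x = x} (direct p) = inj₁ (+-cancelˡ-≡ x _ _ (trans p (sym (+-identityʳ x))))
ahead-self {x = x} (wrap p) = inj₂ (+-cancelˡ-≡ x _ _ p)

round-trip : ∀ x y {k r s} → x + k ≡ y + r → y + k ≡ x + s → k + k ≡ s + r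
round-trip x y {k} {r} {s} p q = +-cancelˡ-≡ x _ _ (begin
  x + (k + k) ≡⟨ +-assoc x k k ⟨
  x + k + k   ≡⟨ cong (_+ k) p ⟩
  y + r + k   ≡⟨ +-comm-middle y r k ⟩
  y + k + r   ≡⟨ cong (_+ r) q ⟩
  x + s + r   ≡⟨ +-assoc x s r ⟩
  x + (s + r) ∎)
  where
  +-comm-middle : ∀ y r k → y + r + k ≡ y + k + r
  +-comm-middle = solve-∀

≡⇒≡+0 : ∀ {m n} → m ≡ n → m ≡ n + 0
≡⇒≡+0 {n = n} eq = trans eq (sym (+-identityʳ n))

ahead-both-ways : ∀ {n k x y} → Ahead n k x y → Ahead n k y x → k + k ≡ 0 ⊎ k + k ≡ n ⊎ k + k ≡ n + n
ahead-both-ways {x = x} {y} (direct p) (direct q) = inj₁ (round-trip x y (≡⇒≡+0 p) (≡⇒≡+0 q))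
ahead-both-ways {n} {x = x} {y} (direct p) (wrap q) =
  inj₂ (inj₁ (trans (round-trip x y (≡⇒≡+0 p) q) (+-identityʳ n)))
ahead-both-ways {x = x} {y} (wrap p) (direct q) = inj₂ (inj₁ (round-trip x y p (≡⇒≡+0 q)))
ahead-both-ways {x = x} {y} (wrap p) (wrap q) = inj₂ (inj₂ (round-trip x y p q))

ahead-asym : ∀ {n k x y} → 0 < k → k + k < n → Ahead n k x y → ¬ Ahead n k y x
ahead-asym 0<k 2k<n p q with ahead-both-ways p q
... | inj₁ eq = <-irrefl (sym eq) (≤-trans 0<k (m≤m+n _ _))
... | inj₂ (inj₁ eq) = <-irrefl eq 2k<n
... | inj₂ (inj₂ eq) = <-irrefl eq (<-≤-trans 2k<n (m≤m+n _ _))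

m+[n∸k]≡o⇒o+k≡m+n : ∀ {m n k o} → k ≤ n → m + (n ∸ k) ≡ o → o + k ≡ m + n
m+[n∸k]≡o⇒o+k≡m+n {m} {n} {k} {o} k≤n p = begin
  o + k           ≡⟨ cong (_+ k) p ⟨
  m + (n ∸ k) + k ≡⟨ +-assoc m (n ∸ k) k ⟩
  m + (n ∸ k + k) ≡⟨ cong (m +_) (m∸n+n≡m k≤n) ⟩
  m + n           ∎

o+k≡m+n⇒m+[n∸k]≡o : ∀ {m n k o} → k ≤ n → o + k ≡ m + n → m + (n ∸ k) ≡ o
o+k≡m+n⇒m+[n∸k]≡o {m} {n} {k} {o} k≤n p =
  +-cancelʳ-≡ k _ _ (trans (m+[n∸k]≡o⇒o+k≡m+n k≤n refl) (sym p))

∣m-n∣≡k⇒m+k≡n⊎n+k≡m : ∀ {m n k} → ∣ m - n ∣ ≡ k → m + k ≡ n ⊎ n + k ≡ m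
∣m-n∣≡k⇒m+k≡n⊎n+k≡m {m} {n} refl with ≤-total m n
... | inj₁ m≤n = inj₁ (trans (cong (m +_) (m≤n⇒∣m-n∣≡n∸m m≤n)) (m+[n∸m]≡n m≤n))
... | inj₂ n≤m = inj₂ (trans (cong (n +_) (m≤n⇒∣n-m∣≡n∸m n≤m)) (m+[n∸m]≡n n≤m))

m⊓[n∸m]≡k : ∀ {m n k} → k + k ≤ n → m ≡ k ⊎ m ≡ n ∸ k → m ⊓ (n ∸ m) ≡ k
m⊓[n∸m]≡k {k = k} 2k≤n (inj₁ refl) = m≤n⇒m⊓n≡m (m+n≤o⇒m≤o∸n k 2k≤n)
m⊓[n∸m]≡k {n = n} {k} 2k≤n (inj₂ refl) =
  trans (cong ((n ∸ k) ⊓_) (m∸[m∸n]≡n (m+n≤o⇒m≤o k 2k≤n))) (m≥n⇒m⊓n≡n (m+n≤o⇒m≤o∸n k 2k≤n))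

m⊓[n∸m]≡k⇒k≤n×[m≡k⊎m≡n∸k] : ∀ {m n k} → m ≤ n → m ⊓ (n ∸ m) ≡ k → k ≤ n × (m ≡ k ⊎ m ≡ n ∸ k)
m⊓[n∸m]≡k⇒k≤n×[m≡k⊎m≡n∸k] {m} {n} m≤n p with ⊓-sel m (n ∸ m)
... | inj₁ q = subst (_≤ n) (trans (sym q) p) m≤n , inj₁ (trans (sym q) p)
... | inj₂ q = subst (_≤ n) (trans (sym q) p) (m∸n≤m n m)
             , inj₂ (trans (sym (m∸[m∸n]≡n m≤n)) (cong (n ∸_) (trans (sym q) p)))

ahead⇒∣-∣ : ∀ {n k x y} → k ≤ n → Ahead n k x y → ∣ x - y ∣ ≡ k ⊎ ∣ x - y ∣ ≡ n ∸ k
ahead⇒∣-∣ {k = k} {x} _ (direct refl) = inj₁ (∣m-m+n∣≡n x k)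
ahead⇒∣-∣ {n} {k} {x} {y} k≤n (wrap p) rewrite sym (o+k≡m+n⇒m+[n∸k]≡o {y} k≤n p) =
  inj₂ (trans (∣-∣-comm (y + (n ∸ k)) y) (∣m-m+n∣≡n y (n ∸ k)))

∣-∣⇒ahead : ∀ {n k x y} → k ≤ n → ∣ x - y ∣ ≡ k ⊎ ∣ x - y ∣ ≡ n ∸ k →
            Ahead n k x y ⊎ Ahead n k y x
∣-∣⇒ahead _ (inj₁ p) with ∣m-n∣≡k⇒m+k≡n⊎n+k≡m p
... | inj₁ q = inj₁ (direct q)
... | inj₂ q = inj₂ (direct q)
∣-∣⇒ahead k≤n (inj₂ p) with ∣m-n∣≡k⇒m+k≡n⊎n+k≡m p
... | inj₁ q = inj₂ (wrap (m+[n∸k]≡o⇒o+k≡m+n k≤n q))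
... | inj₂ q = inj₁ (wrap (m+[n∸k]≡o⇒o+k≡m+n k≤n q))

ahead⇒cdist≡ : ∀ {n k} (i j : Fin n) → k + k ≤ n → Ahead n k (toℕ i) (toℕ j) → cdist n i j ≡ k
ahead⇒cdist≡ {k = k} _ _ 2k≤n i→j = m⊓[n∸m]≡k 2k≤n (ahead⇒∣-∣ (m+n≤o⇒m≤o k 2k≤n) i→j)

cdist≡⇒ahead : ∀ {n k} (i j : Fin n) → cdist n i j ≡ k →
               Ahead n k (toℕ i) (toℕ j) ⊎ Ahead n k (toℕ j) (toℕ i)
cdist≡⇒ahead {n} i j p = uncurry ∣-∣⇒ahead (m⊓[n∸m]≡k⇒k≤n×[m≡k⊎m≡n∸k] d≤n p)
  where
  d≤n : ∣ toℕ i - toℕ j ∣ ≤ n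
  d≤n = ≤-trans (∣m-n∣≤m⊔n (toℕ i) (toℕ j)) (⊔-lub (<⇒≤ (toℕ<n i)) (<⇒≤ (toℕ<n j)))

cdist-self : ∀ {n} (i : Fin n) → cdist n i i ≡ 0
cdist-self i rewrite ∣n-n∣≡0 (toℕ i) = refl

ahead-toℕ-unique : ∀ {n k} {x : ℕ} {i j : Fin n} → Ahead n k x (toℕ i) → Ahead n k x (toℕ j) → i ≡ j
ahead-toℕ-unique {i = i} {j} p q = toℕ-injective (ahead-unique (toℕ<n i) (toℕ<n j) p q)

next : ∀ {n} → Fin (suc n) → Fin (suc n)
next {n} i = (toℕ i + 1) mod suc n

next-ahead : ∀ {n} (i : Fin (suc n)) → Ahead (suc n) 1 (toℕ i) (toℕ (next i))
next-ahead {n} i = subst (Ahead (suc n) 1 (toℕ i)) (sym (toℕ-fromℕ< (m%n<n (toℕ i + 1) (suc n))))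
                         (ahead-mod (toℕ<n i) (s≤s z≤n))

next-≢ : ∀ {n} (i : Fin (suc (suc n))) → next i ≢ i
next-≢ i next≡i with ahead-self (subst (Ahead _ 1 (toℕ i) ∘ toℕ) next≡i (next-ahead i))
... | inj₁ ()
... | inj₂ ()

other : Fin 2 → Fin 2
other 0F = 1F
other 1F = 0F

other-≢ : ∀ h → other h ≢ h
other-≢ 0F ()
other-≢ 1F ()

module _ {G : Graph} {I : Set} (sun : I → Sun G) where

  Covering : V G → V G → Set
  Covering x y = Σ I λ t → Σ SunEdge λ s → EdgeIs (sun t) s x y

  covering-sym : ∀ {x y} → Covering x y → Covering y x
  covering-sym (t , s , inj₁ (p , q)) = t , s , inj₂ (p , q)
  covering-sym (t , s , inj₂ (p , q)) = t , s , inj₁ (p , q)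

  edgeIs-unique : (label : V G → V G → I × SunEdge) →
                  (∀ {x y} → E G x y → label x y ≡ label y x) →
                  (∀ t s → label (vx (sun t) (proj₁ (sunEnds s))) (vx (sun t) (proj₂ (sunEnds s))) ≡ (t , s)) →
                  ∀ {x y t t′ s s′} → E G x y →
                  EdgeIs (sun t) s x y → EdgeIs (sun t′) s′ x y → (t , s) ≡ (t′ , s′)
  edgeIs-unique label label-sym label-sun xy p q = trans (sym (read xy p)) (read xy q)
    where
    read : ∀ {x y t s} → E G x y → EdgeIs (sun t) s x y → label x y ≡ (t , s)
    read _ (inj₁ (refl , refl)) = label-sun _ _
    read xy (inj₂ (refl , refl)) = trans (label-sym xy) (label-sun _ _)

  sunDecomposition : ∀ {n} → Fin n ↔ I → (∀ x y → E G x y → Covering x y) →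
                     (∀ {x y t t′ s s′} → E G x y →
                      EdgeIs (sun t) s x y → EdgeIs (sun t′) s′ x y → (t , s) ≡ (t′ , s′)) →
                     SunDecomposition G
  sunDecomposition {n} enum cover unique =
    record { suns = suns ; cover = cover′ ; unique = unique′ }
    where
    open Inverse enum using (to; from; strictlyInverseˡ; strictlyInverseʳ)
    suns : List (Sun G)
    suns = tabulate (sun ∘ to)
    len : length suns ≡ n
    len = length-tabulate (sun ∘ to)
    index : Fin (length suns) → I
    index i = to (cast len i)
    position : I → Fin (length suns)
    position t = cast (sym len) (from t)
    lookup-suns : ∀ i → lookup suns i ≡ sun (index i)
    lookup-suns i = trans (cong (lookup suns) (sym (cast-involutive (sym len) len i)))
                          (lookup-tabulate (sun ∘ to) (cast len i))
    index-position : ∀ t → index (position t) ≡ t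
    index-position t = trans (cong to (cast-involutive len (sym len) (from t))) (strictlyInverseˡ t)
    position-index : ∀ i → position (index i) ≡ i
    position-index i = trans (cong (cast (sym len)) (strictlyInverseʳ (cast len i)))
                             (cast-involutive (sym len) len i)
    cover′ : ∀ x y → E G x y → Σ (Fin (length suns)) λ i → Σ SunEdge λ s → EdgeIs (lookup suns i) s x y
    cover′ x y xy with cover x y xy
    ... | t , s , edge = position t , s ,
      subst (λ S → EdgeIs S s x y) (sym (trans (lookup-suns (position t)) (cong sun (index-position t)))) edge
    unique′ : ∀ x y → E G x y → ∀ i i′ s s′ → EdgeIs (lookup suns i) s x y →
              EdgeIs (lookup suns i′) s′ x y → (i ≡ i′) × (s ≡ s′)
    unique′ x y xy i i′ s s′ p q = i≡i′ , cong proj₂ same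
      where
      same : (index i , s) ≡ (index i′ , s′)
      same = unique xy (subst (λ S → EdgeIs S s x y) (lookup-suns i) p)
                       (subst (λ S → EdgeIs S s′ x y) (lookup-suns i′) q)
      i≡i′ : i ≡ i′
      i≡i′ = trans (sym (position-index i)) (trans (cong (position ∘ proj₁) same) (position-index i′))

ahead-next-block : ∀ {n q q′} r → Ahead n 1 q q′ → Ahead (n * 4) 2 (4 * q + (2 + r)) (4 * q′ + r)
ahead-next-block {n} {q} {q′} r = shifted
  where
  shift : ∀ q r → 4 * q + (2 + r) + 2 ≡ 4 * (q + 1) + r
  shift = solve-∀
  unwrap : ∀ q′ n r → 4 * (q′ + n) + r ≡ 4 * q′ + r + n * 4
  unwrap = solve-∀
  shifted : Ahead n 1 q q′ → Ahead (n * 4) 2 (4 * q + (2 + r)) (4 * q′ + r)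
  shifted (direct p) = direct (trans (shift q r) (cong (λ z → 4 * z + r) p))
  shifted (wrap p) = wrap (trans (shift q r) (trans (cong (λ z → 4 * z + r) p) (unwrap q′ n r)))

module SunsOnCycle (m : ℕ) where

  K : ℕ
  K = 2 + m

  u : ℕ
  u = K * 4

  G : Graph
  G = Cayley u 2 (_≡ 2)

  Vertex : Set
  Vertex = Fin u ⊎ Fin 2

  Point : Set
  Point = Fin K × Fin 2 × Fin 2

  encode : Point → Fin u
  encode (q , j , h) = combine q (combine j h)

  decode : Fin u → Point
  decode x = map₂ (remQuot 2) (remQuot {K} 4 x)

  decode-encode : ∀ p → decode (encode p) ≡ p
  decode-encode (q , j , h) =
    trans (cong (map₂ (remQuot 2)) (remQuot-combine {K} {4} q (combine j h)))
          (cong (q ,_) (remQuot-combine {2} {2} j h))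

  encode-decode : ∀ x → encode (decode x) ≡ x
  encode-decode x = trans (cong (combine q) (combine-remQuot {2} 2 r)) (combine-remQuot {K} 4 x)
    where
    q : Fin K
    q = proj₁ (remQuot {K} 4 x)
    r : Fin 4
    r = proj₂ (remQuot {K} 4 x)

  data Encoded : Fin u → Set where
    encoded : ∀ p → Encoded (encode p)

  encode-view : ∀ x → Encoded x
  encode-view x = subst Encoded (encode-decode x) (encoded (decode x))

  toℕ-encode : ∀ q j h → toℕ (encode (q , j , h)) ≡ 4 * toℕ q + (2 * toℕ j + toℕ h)
  toℕ-encode q j h = trans (toℕ-combine q (combine j h)) (cong (4 * toℕ q +_) (toℕ-combine j h))

  ahead-within : ∀ q h → Ahead u 2 (toℕ (encode (q , 0F , h))) (toℕ (encode (q , 1F , h)))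
  ahead-within q h rewrite toℕ-encode q 0F h | toℕ-encode q 1F h =
    direct (trans (+-assoc (4 * toℕ q) (toℕ h) 2) (cong (4 * toℕ q +_) (+-comm (toℕ h) 2)))

  ahead-across : ∀ q h → Ahead u 2 (toℕ (encode (q , 1F , h))) (toℕ (encode (next q , 0F , h)))
  ahead-across q h rewrite toℕ-encode q 1F h | toℕ-encode (next q) 0F h =
    ahead-next-block (toℕ h) (next-ahead q)

  ahead⇒edge : ∀ {x y} → Ahead u 2 (toℕ x) (toℕ y) → E G (inj₁ x) (inj₁ y)
  ahead⇒edge {x} {y} x→y = x≢y , distance
    where
    distance : cdist u x y ≡ 2
    distance = ahead⇒cdist≡ x y (m≤m+n 4 _) x→y
    x≢y : x ≢ y
    x≢y refl = 0≢1+n (trans (sym (cdist-self x)) distance)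

  Index : Set
  Index = Fin K × Fin 2

  sunVertex : Index → SunVertex → Vertex
  sunVertex (q , h) a = inj₁ (encode (q , 0F , h))
  sunVertex (q , h) b = inj₁ (encode (q , 1F , h))
  sunVertex (q , h) c = inj₂ h
  sunVertex (q , h) d = inj₂ (other h)
  sunVertex (q , h) e = inj₁ (encode (next q , 0F , h))
  sunVertex (q , h) f = inj₁ (encode (q , 1F , other h))

  locatePoint : Index → Point → SunVertex
  locatePoint (q , _) (q′ , 0F , _) = if does (q′ Fin.≟ q) then a else e
  locatePoint (_ , h) (_ , 1F , h′) = if does (h′ Fin.≟ h) then b else f

  locate : Index → Vertex → SunVertex
  locate t (inj₁ x) = locatePoint t (decode x)
  locate (_ , h) (inj₂ k) = if does (k Fin.≟ h) then c else d

  locate-encode : ∀ t p → locate t (inj₁ (encode p)) ≡ locatePoint t p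
  locate-encode t p = cong (locatePoint t) (decode-encode p)

  locate-sunVertex : ∀ t v → locate t (sunVertex t v) ≡ v
  locate-sunVertex (q , h) a = trans (locate-encode (q , h) (q , 0F , h)) (if-does-yes (q Fin.≟ q) refl)
  locate-sunVertex (q , h) b = trans (locate-encode (q , h) (q , 1F , h)) (if-does-yes (h Fin.≟ h) refl)
  locate-sunVertex (q , h) c = if-does-yes (h Fin.≟ h) refl
  locate-sunVertex (q , h) d = if-does-no (other h Fin.≟ h) (other-≢ h)
  locate-sunVertex (q , h) e =
    trans (locate-encode (q , h) (next q , 0F , h)) (if-does-no (next q Fin.≟ q) (next-≢ q))
  locate-sunVertex (q , h) f =
    trans (locate-encode (q , h) (q , 1F , other h)) (if-does-no (other h Fin.≟ h) (other-≢ h))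

  sunVertex-injective : ∀ t → Injective _≡_ _≡_ (sunVertex t)
  sunVertex-injective t {v} {w} eq =
    trans (sym (locate-sunVertex t v)) (trans (cong (locate t) eq) (locate-sunVertex t w))

  sun-edges : ∀ t s → E G (sunVertex t (proj₁ (sunEnds s))) (sunVertex t (proj₂ (sunEnds s)))
  sun-edges (q , h) ab = ahead⇒edge (ahead-within q h)
  sun-edges _ bc = tt
  sun-edges _ ca = tt
  sun-edges _ ad = tt
  sun-edges (q , h) be = ahead⇒edge (ahead-across q h)
  sun-edges _ cf = tt

  sun : Index → Sun G
  sun t = record
    { vx = sunVertex t
    ; inj = sunVertex-injective t
    ; edges = sun-edges t
    }

  cycleLabel : Point → Index × SunEdge
  cycleLabel (q , 0F , h) = (q , h) , ab
  cycleLabel (q , 1F , h) = (q , h) , be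

  infinityLabel : Point → Fin 2 → Index × SunEdge
  infinityLabel (q , 0F , h) k = (q , h) , (if does (k Fin.≟ h) then ca else ad)
  infinityLabel (q , 1F , h) k = (q , k) , (if does (k Fin.≟ h) then bc else cf)

  ahead-one-way : ∀ {x y} → Ahead u 2 x y → ¬ Ahead u 2 y x
  ahead-one-way = ahead-asym (s≤s z≤n) (m≤m+n 5 _)

  label : Vertex → Vertex → Index × SunEdge
  label (inj₁ x) (inj₁ y) =
    if does (ahead? u 2 (toℕ x) (toℕ y)) then cycleLabel (decode x) else cycleLabel (decode y)
  label (inj₁ x) (inj₂ k) = infinityLabel (decode x) k
  label (inj₂ k) (inj₁ x) = infinityLabel (decode x) k
  label (inj₂ _) (inj₂ _) = (zero , 0F) , ab

  label-sym : ∀ {x y} → E G x y → label x y ≡ label y x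
  label-sym {inj₁ x} {inj₁ y} (_ , distance) with cdist≡⇒ahead x y distance
  ... | inj₁ x→y = trans (if-does-yes (ahead? u 2 (toℕ x) (toℕ y)) x→y)
                         (sym (if-does-no (ahead? u 2 (toℕ y) (toℕ x)) (ahead-one-way x→y)))
  ... | inj₂ y→x = trans (if-does-no (ahead? u 2 (toℕ x) (toℕ y)) (ahead-one-way y→x))
                         (sym (if-does-yes (ahead? u 2 (toℕ y) (toℕ x)) y→x))
  label-sym {inj₁ _} {inj₂ _} _ = refl
  label-sym {inj₂ _} {inj₁ _} _ = refl

  label-encode : ∀ p k → label (inj₂ k) (inj₁ (encode p)) ≡ infinityLabel p k
  label-encode p k = cong (λ p′ → infinityLabel p′ k) (decode-encode p)

  label-sun : ∀ t s → label (sunVertex t (proj₁ (sunEnds s))) (sunVertex t (proj₂ (sunEnds s))) ≡ (t , s)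
  label-sun (q , h) ab =
    trans (if-does-yes (ahead? u 2 _ _) (ahead-within q h)) (cong cycleLabel (decode-encode (q , 0F , h)))
  label-sun (q , h) be =
    trans (if-does-yes (ahead? u 2 _ _) (ahead-across q h)) (cong cycleLabel (decode-encode (q , 1F , h)))
  label-sun (q , h) bc =
    trans (label-encode (q , 1F , h) h) (cong ((q , h) ,_) (if-does-yes (h Fin.≟ h) refl))
  label-sun (q , h) ca =
    trans (label-encode (q , 0F , h) h) (cong ((q , h) ,_) (if-does-yes (h Fin.≟ h) refl))
  label-sun (q , h) ad =
    trans (label-encode (q , 0F , h) (other h)) (cong ((q , h) ,_) (if-does-no (other h Fin.≟ h) (other-≢ h)))
  label-sun (q , h) cf =
    trans (label-encode (q , 1F , other h) h) (cong ((q , h) ,_) (if-does-no (h Fin.≟ other h) (other-≢ h ∘ sym)))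

  cover-cycle : ∀ {x y} → Ahead u 2 (toℕ x) (toℕ y) → Covering sun (inj₁ x) (inj₁ y)
  cover-cycle {x} x→y with encode-view x
  ... | encoded (q , 0F , h) =
    (q , h) , ab , inj₁ (refl , cong inj₁ (ahead-toℕ-unique (ahead-within q h) x→y))
  ... | encoded (q , 1F , h) =
    (q , h) , be , inj₁ (refl , cong inj₁ (ahead-toℕ-unique (ahead-across q h) x→y))

  cover-infinity : ∀ x k → Covering sun (inj₁ x) (inj₂ k)
  cover-infinity x k with encode-view x | k
  ... | encoded (q , 0F , 0F) | 0F = (q , 0F) , ca , inj₂ (refl , refl)
  ... | encoded (q , 0F , 0F) | 1F = (q , 0F) , ad , inj₁ (refl , refl)
  ... | encoded (q , 0F , 1F) | 0F = (q , 1F) , ad , inj₁ (refl , refl)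
  ... | encoded (q , 0F , 1F) | 1F = (q , 1F) , ca , inj₂ (refl , refl)
  ... | encoded (q , 1F , 0F) | 0F = (q , 0F) , bc , inj₁ (refl , refl)
  ... | encoded (q , 1F , 0F) | 1F = (q , 1F) , cf , inj₂ (refl , refl)
  ... | encoded (q , 1F , 1F) | 0F = (q , 0F) , cf , inj₂ (refl , refl)
  ... | encoded (q , 1F , 1F) | 1F = (q , 1F) , bc , inj₁ (refl , refl)

  cover : ∀ x y → E G x y → Covering sun x y
  cover (inj₁ x) (inj₁ y) (_ , distance) with cdist≡⇒ahead x y distance
  ... | inj₁ x→y = cover-cycle x→y
  ... | inj₂ y→x = covering-sym sun (cover-cycle y→x)
  cover (inj₁ x) (inj₂ k) _ = cover-infinity x k
  cover (inj₂ k) (inj₁ x) _ = covering-sym sun (cover-infinity x k)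

  decomposition : SunDecomposition G
  decomposition = sunDecomposition sun *↔× cover (edgeIs-unique sun label label-sym label-sun)

lemma2p1 : (u : ℕ) → 4 ∣ u → 8 ≤ u → SunDecomposition (Cayley u 2 (_≡ 2))
lemma2p1 _ (divides 0 refl) ()
lemma2p1 _ (divides 1 refl) (s≤s (s≤s (s≤s (s≤s ()))))
lemma2p1 _ (divides (suc (suc m)) refl) _ = SunsOnCycle.decomposition m
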